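{- Let $z_0,z_1,z_2,\dots$ be indeterminates, $Z=\sum_{i\ge0}z_it^i$, and $\mathbb A=\mathbb N[z_0,z_1,z_2,\dots]$. For polynomials $A,B\in\mathbb A[t]$ put $e(A)=\langle Z,A\rangle+tA$ and $f(A)=\langle Z,A\rangle$. Then for all $A,B\in\mathbb A[t]$, $$f\big(A\cdot e(B)\big)=f\big(e(A)\cdot B\big).$$ Consequently, defining for every finite rooted tree $R$ the polynomial $I(R)\in\mathbb A[t]$ by $I(R)=1$ if $R$ is a single vertex and $I(R)=\prod_{c}e\big(I(R_c)\big)$ otherwise (product over the children $c$ of the root, $R_c$ being the subtree of descendants of $c$ rooted at $c$), the value $f(I(R))\in\mathbb A$ depends only on the unrooted tree underlying $R$, i.e. it does not depend on which vertex of a given finite tree is chosen as root.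
   Context: For a formal power series $Z=\sum_{i\ge0}z_it^i$ and a polynomial $B=\sum_{i=0}^Nb_it^i$ with coefficients in a commutative ring, $\langle Z,B\rangle=\sum_{i=0}^Nz_ib_i$. -}

module Defs where

open import Level using (Level)
open import Algebra.Bundles using (CommutativeSemiring)
open import Data.Nat using (ℕ; suc)
open import Data.Fin using (Fin)
open import Data.List using (List; []; _∷_; map; length; lookup; removeAt; _++_)
open import Data.Maybe using (Maybe; just; nothing)

-- Finite rooted trees (rose trees): a root together with the list of
-- subtrees R_c hanging at its children c.

data RTree : Set where
  node : List RTree → RTree

children : RTree → List RTree
children (node cs) = cs

-- Vertices of a rooted tree, given as paths from the root.
data Pos : RTree → Set where
  here  : ∀ {t} → Pos t
  child : ∀ {cs} (i : Fin (length cs)) → Pos (lookup cs i) → Pos (node cs)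

-- Re-rooting: the rooted tree with the same underlying unrooted tree
-- as t, but rooted at the vertex v.  The first argument is the part of
-- the original tree "above" the current vertex (hanging as an extra
-- child of the current vertex after re-rooting), if any.
private
  maybeList : Maybe RTree → List RTree
  maybeList nothing  = []
  maybeList (just u) = u ∷ []

rerootWith : Maybe RTree → (t : RTree) → Pos t → RTree
rerootWith up (node cs) here        = node (cs ++ maybeList up)
rerootWith up (node cs) (child i p) =
  rerootWith (just (node (removeAt cs i ++ maybeList up))) (lookup cs i) p

reroot : (t : RTree) → Pos t → RTree
reroot t v = rerootWith nothing t v

-- Polynomials in t over a commutative semiring, as coefficient lists
-- (lowest degree first), and the operations of the paper.

module Poly {c ℓ : Level} (R : CommutativeSemiring c ℓ) (z : ℕ → CommutativeSemiring.Carrier R) where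
  open CommutativeSemiring R

  Pol : Set c
  Pol = List Carrier

  _+ₚ_ : Pol → Pol → Pol
  []      +ₚ q       = q
  (a ∷ p) +ₚ []      = a ∷ p
  (a ∷ p) +ₚ (b ∷ q) = (a + b) ∷ (p +ₚ q)

  _·ₚ_ : Carrier → Pol → Pol
  a ·ₚ q = map (a *_) q

  _*ₚ_ : Pol → Pol → Pol
  []      *ₚ q = []
  (a ∷ p) *ₚ q = (a ·ₚ q) +ₚ (0# ∷ (p *ₚ q))

  1ₚ : Pol
  1ₚ = 1# ∷ []

  const : Carrier → Pol
  const a = a ∷ []

  tₚ* : Pol → Pol
  tₚ* p = 0# ∷ p

  pairingFrom : ℕ → Pol → Carrier
  pairingFrom k []      = 0#
  pairingFrom k (b ∷ B) = z k * b + pairingFrom (suc k) B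

  ⟨Z,_⟩ : Pol → Carrier
  ⟨Z, B ⟩ = pairingFrom 0 B

  e : Pol → Pol
  e A = const ⟨Z, A ⟩ +ₚ tₚ* A

  f : Pol → Carrier
  f A = ⟨Z, A ⟩

  mutual
    I : RTree → Pol
    I (node []) = 1ₚ
    I (node (c ∷ cs)) = prodE (c ∷ cs)

    prodE : List RTree → Pol
    prodE []       = 1ₚ
    prodE (c ∷ cs) = e (I c) *ₚ prodE cs

module Submission where

-- Polynomials are coefficient lists, so one polynomial has many
-- representations (trailing zeros, 0 + 0 versus 0).
--
-- Part 1: e(A) = ⟨Z,A⟩ + tA gives f(e(A)·B) = ⟨Z,A⟩⟨Z,B⟩ + f(t·AB), which
-- is symmetric in A and B; commutativity of *ₚ turns A·e(B) into e(B)·A.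
--
-- Moving the root to a child c swaps the roles of A = I(R_c) and
-- B = (product over the remaining children), so Part 1 says f is unchanged.
-- Induction along the path to the new root, carrying the factor of the
-- part of the tree already left "above", gives f(I(reroot T v)) = f(I(T)).

open import Defs
open import Level using (Level)
open import Algebra.Bundles using (CommutativeSemiring)
open import Data.Nat using (ℕ; zero; suc)
open import Data.Product using (_×_; _,_)
open import Data.Fin using (Fin; zero; suc)
open import Data.List using (List; []; _∷_; length; lookup; removeAt; _++_)
open import Data.Maybe using (Maybe; just; nothing)
open import Relation.Binary.Bundles using (Setoid)
import Algebra.Properties.CommutativeSemigroup as CommSemigroupProperties
import Relation.Binary.Reasoning.Setoid as SetoidReasoning

module Proof {c ℓ : Level} (R : CommutativeSemiring c ℓ)
             (z : ℕ → CommutativeSemiring.Carrier R) where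
  open CommutativeSemiring R
  open Poly R z
  open CommSemigroupProperties +-commutativeSemigroup
    using () renaming (interchange to +-interchange; x∙yz≈y∙xz to +-swap)
  open CommSemigroupProperties *-commutativeSemigroup
    using () renaming (x∙yz≈y∙xz to *-swap)

  coeff : Pol → ℕ → Carrier
  coeff []      n       = 0#
  coeff (a ∷ p) zero    = a
  coeff (a ∷ p) (suc n) = coeff p n

  infix 4 _≋_
  record _≋_ (p q : Pol) : Set ℓ where
    constructor byCoeff
    field coeff-≈ : ∀ n → coeff p n ≈ coeff q n
  open _≋_

  ≋-setoid : Setoid c ℓ
  ≋-setoid = record
    { Carrier       = Pol
    ; _≈_           = _≋_
    ; isEquivalence = record
      { refl  = byCoeff λ n → refl
      ; sym   = λ p≋q → byCoeff λ n → sym (coeff-≈ p≋q n)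
      ; trans = λ p≋q q≋r → byCoeff λ n → trans (coeff-≈ p≋q n) (coeff-≈ q≋r n)
      }
    }
  open Setoid ≋-setoid using ()
    renaming (refl to ≋-refl; sym to ≋-sym; trans to ≋-trans)

  ∷-cong : ∀ {a b p q} → a ≈ b → p ≋ q → a ∷ p ≋ b ∷ q
  ∷-cong a≈b p≋q = byCoeff λ { zero → a≈b ; (suc n) → coeff-≈ p≋q n }

  ∷-injective : ∀ {a b p q} → a ∷ p ≋ b ∷ q → a ≈ b × p ≋ q
  ∷-injective h = coeff-≈ h 0 , byCoeff λ n → coeff-≈ h (suc n)

  null-∷ : ∀ {p} → [] ≋ p → [] ≋ 0# ∷ p
  null-∷ p≋0 = byCoeff λ { zero → refl ; (suc n) → coeff-≈ p≋0 n }

  coeff-+ₚ : ∀ p q n → coeff (p +ₚ q) n ≈ coeff p n + coeff q n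
  coeff-+ₚ []      q       n       = sym (+-identityˡ _)
  coeff-+ₚ (a ∷ p) []      n       = sym (+-identityʳ _)
  coeff-+ₚ (a ∷ p) (b ∷ q) zero    = refl
  coeff-+ₚ (a ∷ p) (b ∷ q) (suc n) = coeff-+ₚ p q n

  coeff-·ₚ : ∀ a q n → coeff (a ·ₚ q) n ≈ a * coeff q n
  coeff-·ₚ a []      n       = sym (zeroʳ a)
  coeff-·ₚ a (b ∷ q) zero    = refl
  coeff-·ₚ a (b ∷ q) (suc n) = coeff-·ₚ a q n

  +ₚ-cong : ∀ {p p′ q q′} → p ≋ p′ → q ≋ q′ → p +ₚ q ≋ p′ +ₚ q′
  +ₚ-cong {p} {p′} {q} {q′} p≋p′ q≋q′ = byCoeff λ n → begin
    coeff (p +ₚ q) n       ≈⟨ coeff-+ₚ p q n ⟩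
    coeff p n + coeff q n   ≈⟨ +-cong (coeff-≈ p≋p′ n) (coeff-≈ q≋q′ n) ⟩
    coeff p′ n + coeff q′ n ≈⟨ coeff-+ₚ p′ q′ n ⟨
    coeff (p′ +ₚ q′) n     ∎
    where open SetoidReasoning setoid

  ·ₚ-cong : ∀ {a b q q′} → a ≈ b → q ≋ q′ → a ·ₚ q ≋ b ·ₚ q′
  ·ₚ-cong {a} {b} {q} {q′} a≈b q≋q′ = byCoeff λ n →
    trans (coeff-·ₚ a q n) (trans (*-cong a≈b (coeff-≈ q≋q′ n)) (sym (coeff-·ₚ b q′ n)))

  +ₚ-identityʳ : ∀ p → p +ₚ [] ≋ p
  +ₚ-identityʳ p = byCoeff λ n → trans (coeff-+ₚ p [] n) (+-identityʳ _)

  +ₚ-interchange : ∀ w x y u → (w +ₚ x) +ₚ (y +ₚ u) ≋ (w +ₚ y) +ₚ (x +ₚ u)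
  +ₚ-interchange w x y u = byCoeff λ n → begin
    coeff ((w +ₚ x) +ₚ (y +ₚ u)) n
      ≈⟨ trans (coeff-+ₚ (w +ₚ x) (y +ₚ u) n) (+-cong (coeff-+ₚ w x n) (coeff-+ₚ y u n)) ⟩
    (coeff w n + coeff x n) + (coeff y n + coeff u n)
      ≈⟨ +-interchange _ _ _ _ ⟩
    (coeff w n + coeff y n) + (coeff x n + coeff u n)
      ≈⟨ trans (coeff-+ₚ (w +ₚ y) (x +ₚ u) n) (+-cong (coeff-+ₚ w y n) (coeff-+ₚ x u n)) ⟨
    coeff ((w +ₚ y) +ₚ (x +ₚ u)) n ∎
    where open SetoidReasoning setoid

  +ₚ-swap : ∀ x y u → x +ₚ (y +ₚ u) ≋ y +ₚ (x +ₚ u)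
  +ₚ-swap x y u = byCoeff λ n → begin
    coeff (x +ₚ (y +ₚ u)) n
      ≈⟨ trans (coeff-+ₚ x (y +ₚ u) n) (+-congˡ (coeff-+ₚ y u n)) ⟩
    coeff x n + (coeff y n + coeff u n)
      ≈⟨ +-swap _ _ _ ⟩
    coeff y n + (coeff x n + coeff u n)
      ≈⟨ trans (coeff-+ₚ y (x +ₚ u) n) (+-congˡ (coeff-+ₚ x u n)) ⟨
    coeff (y +ₚ (x +ₚ u)) n ∎
    where open SetoidReasoning setoid

  ·ₚ-distribˡ : ∀ a p q → a ·ₚ (p +ₚ q) ≋ (a ·ₚ p) +ₚ (a ·ₚ q)
  ·ₚ-distribˡ a p q = byCoeff λ n → begin
    coeff (a ·ₚ (p +ₚ q)) n
      ≈⟨ trans (coeff-·ₚ a (p +ₚ q) n) (*-congˡ (coeff-+ₚ p q n)) ⟩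
    a * (coeff p n + coeff q n)
      ≈⟨ distribˡ a _ _ ⟩
    a * coeff p n + a * coeff q n
      ≈⟨ trans (coeff-+ₚ (a ·ₚ p) (a ·ₚ q) n) (+-cong (coeff-·ₚ a p n) (coeff-·ₚ a q n)) ⟨
    coeff ((a ·ₚ p) +ₚ (a ·ₚ q)) n ∎
    where open SetoidReasoning setoid

  ·ₚ-distribʳ : ∀ a b p → (a + b) ·ₚ p ≋ (a ·ₚ p) +ₚ (b ·ₚ p)
  ·ₚ-distribʳ a b p = byCoeff λ n → begin
    coeff ((a + b) ·ₚ p) n        ≈⟨ coeff-·ₚ (a + b) p n ⟩
    (a + b) * coeff p n           ≈⟨ distribʳ _ a b ⟩
    a * coeff p n + b * coeff p n
      ≈⟨ trans (coeff-+ₚ (a ·ₚ p) (b ·ₚ p) n) (+-cong (coeff-·ₚ a p n) (coeff-·ₚ b p n)) ⟨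
    coeff ((a ·ₚ p) +ₚ (b ·ₚ p)) n ∎
    where open SetoidReasoning setoid

  ·ₚ-assoc : ∀ a b p → a ·ₚ (b ·ₚ p) ≋ (a * b) ·ₚ p
  ·ₚ-assoc a b p = byCoeff λ n →
    trans (coeff-·ₚ a (b ·ₚ p) n)
      (trans (*-congˡ (coeff-·ₚ b p n)) (trans (sym (*-assoc a b _)) (sym (coeff-·ₚ (a * b) p n))))

  ·ₚ-zeroˡ : ∀ p → 0# ·ₚ p ≋ []
  ·ₚ-zeroˡ p = byCoeff λ n → trans (coeff-·ₚ 0# p n) (zeroˡ _)

  *ₚ-congʳ : ∀ p {q q′} → q ≋ q′ → p *ₚ q ≋ p *ₚ q′
  *ₚ-congʳ []      q≋q′ = ≋-refl
  *ₚ-congʳ (a ∷ p) q≋q′ = +ₚ-cong (·ₚ-cong refl q≋q′) (∷-cong refl (*ₚ-congʳ p q≋q′))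

  *ₚ-zeroʳ : ∀ q → [] ≋ q *ₚ []
  *ₚ-zeroʳ []      = ≋-refl
  *ₚ-zeroʳ (b ∷ q) = null-∷ (*ₚ-zeroʳ q)

  -- Multiplying by b ∷ B = b + t·B on the right; the definition of *ₚ
  -- gives this expansion only on the left.
  *ₚ-∷ʳ : ∀ A b B → A *ₚ (b ∷ B) ≋ (b ·ₚ A) +ₚ (0# ∷ (A *ₚ B))
  *ₚ-∷ʳ []      b B = null-∷ ≋-refl
  *ₚ-∷ʳ (a ∷ A) b B =
    ∷-cong (+-congʳ (*-comm a b))
      (≋-trans (+ₚ-cong ≋-refl (*ₚ-∷ʳ A b B)) (+ₚ-swap (a ·ₚ B) (b ·ₚ A) (0# ∷ (A *ₚ B))))

  *ₚ-comm : ∀ p q → p *ₚ q ≋ q *ₚ p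
  *ₚ-comm []      q = *ₚ-zeroʳ q
  *ₚ-comm (a ∷ p) q =
    ≋-trans (+ₚ-cong ≋-refl (∷-cong refl (*ₚ-comm p q))) (≋-sym (*ₚ-∷ʳ q a p))

  *ₚ-congˡ : ∀ {p p′} q → p ≋ p′ → p *ₚ q ≋ p′ *ₚ q
  *ₚ-congˡ {p} {p′} q p≋p′ =
    ≋-trans (*ₚ-comm p q) (≋-trans (*ₚ-congʳ q p≋p′) (*ₚ-comm q p′))

  *ₚ-distribʳ : ∀ p q r → (p +ₚ q) *ₚ r ≋ (p *ₚ r) +ₚ (q *ₚ r)
  *ₚ-distribʳ []      q       r = ≋-refl
  *ₚ-distribʳ (a ∷ p) []      r = ≋-sym (+ₚ-identityʳ _)
  *ₚ-distribʳ (a ∷ p) (b ∷ q) r =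
    ≋-trans (+ₚ-cong (·ₚ-distribʳ a b r) (∷-cong (sym (+-identityˡ 0#)) (*ₚ-distribʳ p q r)))
            (+ₚ-interchange (a ·ₚ r) (b ·ₚ r) (0# ∷ (p *ₚ r)) (0# ∷ (q *ₚ r)))

  ·ₚ-*ₚ : ∀ a q r → (a ·ₚ q) *ₚ r ≋ a ·ₚ (q *ₚ r)
  ·ₚ-*ₚ a []      r = ≋-refl
  ·ₚ-*ₚ a (b ∷ q) r =
    ≋-trans (+ₚ-cong (≋-sym (·ₚ-assoc a b r)) (∷-cong (sym (zeroʳ a)) (·ₚ-*ₚ a q r)))
            (≋-sym (·ₚ-distribˡ a (b ·ₚ r) (0# ∷ (q *ₚ r))))

  tₚ*-*ₚ : ∀ p r → tₚ* p *ₚ r ≋ tₚ* (p *ₚ r)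
  tₚ*-*ₚ p r = +ₚ-cong (·ₚ-zeroˡ r) ≋-refl

  *ₚ-assoc : ∀ p q r → (p *ₚ q) *ₚ r ≋ p *ₚ (q *ₚ r)
  *ₚ-assoc []      q r = ≋-refl
  *ₚ-assoc (a ∷ p) q r =
    ≋-trans (*ₚ-distribʳ (a ·ₚ q) (0# ∷ (p *ₚ q)) r)
      (+ₚ-cong (·ₚ-*ₚ a q r) (≋-trans (tₚ*-*ₚ (p *ₚ q) r) (∷-cong refl (*ₚ-assoc p q r))))

  *ₚ-identityˡ : ∀ q → 1ₚ *ₚ q ≋ q
  *ₚ-identityˡ q = byCoeff λ n →
    trans (coeff-+ₚ (1# ·ₚ q) (0# ∷ []) n)
      (trans (+-cong (coeff-·ₚ 1# q n) (coeff-zero n)) (trans (+-identityʳ _) (*-identityˡ _)))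
    where
    coeff-zero : ∀ n → coeff (0# ∷ []) n ≈ 0#
    coeff-zero zero    = refl
    coeff-zero (suc n) = refl

  *ₚ-identityʳ : ∀ q → q *ₚ 1ₚ ≋ q
  *ₚ-identityʳ q = ≋-trans (*ₚ-comm q 1ₚ) (*ₚ-identityˡ q)

  *ₚ-swap : ∀ x y p → x *ₚ (y *ₚ p) ≋ y *ₚ (x *ₚ p)
  *ₚ-swap x y p =
    ≋-trans (≋-sym (*ₚ-assoc x y p)) (≋-trans (*ₚ-congˡ p (*ₚ-comm x y)) (*ₚ-assoc y x p))

  pairing-null : ∀ k q → [] ≋ q → pairingFrom k q ≈ 0#
  pairing-null k []      q≋0 = refl
  pairing-null k (b ∷ q) q≋0 =
    trans (+-cong (trans (*-congˡ (sym (coeff-≈ q≋0 0))) (zeroʳ _))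
                  (pairing-null (suc k) q (byCoeff λ n → coeff-≈ q≋0 (suc n))))
          (+-identityˡ 0#)

  pairing-cong : ∀ k {p q} → p ≋ q → pairingFrom k p ≈ pairingFrom k q
  pairing-cong k {[]}    {q}     p≋q = sym (pairing-null k q p≋q)
  pairing-cong k {a ∷ p} {[]}    p≋q = pairing-null k (a ∷ p) (≋-sym p≋q)
  pairing-cong k {a ∷ p} {b ∷ q} p≋q =
    let a≈b , p′≋q′ = ∷-injective p≋q in
    +-cong (*-congˡ a≈b) (pairing-cong (suc k) p′≋q′)

  pairing-+ₚ : ∀ k p q → pairingFrom k (p +ₚ q) ≈ pairingFrom k p + pairingFrom k q
  pairing-+ₚ k []      q       = sym (+-identityˡ _)
  pairing-+ₚ k (a ∷ p) []      = sym (+-identityʳ _)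
  pairing-+ₚ k (a ∷ p) (b ∷ q) =
    trans (+-cong (distribˡ (z k) a b) (pairing-+ₚ (suc k) p q)) (+-interchange _ _ _ _)

  pairing-·ₚ : ∀ k a q → pairingFrom k (a ·ₚ q) ≈ a * pairingFrom k q
  pairing-·ₚ k a []      = sym (zeroʳ a)
  pairing-·ₚ k a (b ∷ q) =
    trans (+-cong (*-swap (z k) a b) (pairing-·ₚ (suc k) a q)) (sym (distribˡ a _ _))

  f-cong : ∀ {p q} → p ≋ q → f p ≈ f q
  f-cong = pairing-cong 0

  e-cong : ∀ {p q} → p ≋ q → e p ≋ e q
  e-cong p≋q = ∷-cong (+-congʳ (f-cong p≋q)) p≋q

  -- Expanding e(A) = ⟨Z,A⟩ + t·A exhibits a value symmetric in A and B.
  f-e*ₚ : ∀ A B → f (e A *ₚ B) ≈ ⟨Z, A ⟩ * ⟨Z, B ⟩ + f (tₚ* (A *ₚ B))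
  f-e*ₚ A B = begin
    f (((⟨Z, A ⟩ + 0#) ·ₚ B) +ₚ tₚ* (A *ₚ B))              ≈⟨ pairing-+ₚ 0 ((⟨Z, A ⟩ + 0#) ·ₚ B) (tₚ* (A *ₚ B)) ⟩
    f ((⟨Z, A ⟩ + 0#) ·ₚ B) + f (tₚ* (A *ₚ B))            ≈⟨ +-congʳ (pairing-·ₚ 0 _ B) ⟩
    (⟨Z, A ⟩ + 0#) * ⟨Z, B ⟩ + f (tₚ* (A *ₚ B))            ≈⟨ +-congʳ (*-congʳ (+-identityʳ _)) ⟩
    ⟨Z, A ⟩ * ⟨Z, B ⟩ + f (tₚ* (A *ₚ B))                   ∎
    where open SetoidReasoning setoid

  e-adjoint : (A B : Pol) → f (A *ₚ e B) ≈ f (e A *ₚ B)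
  e-adjoint A B = begin
    f (A *ₚ e B)                             ≈⟨ f-cong (*ₚ-comm A (e B)) ⟩
    f (e B *ₚ A)                             ≈⟨ f-e*ₚ B A ⟩
    ⟨Z, B ⟩ * ⟨Z, A ⟩ + f (tₚ* (B *ₚ A))    ≈⟨ +-cong (*-comm _ _) (f-cong (∷-cong refl (*ₚ-comm B A))) ⟩
    ⟨Z, A ⟩ * ⟨Z, B ⟩ + f (tₚ* (A *ₚ B))    ≈⟨ f-e*ₚ A B ⟨
    f (e A *ₚ B)                             ∎
    where open SetoidReasoning setoid

  I≋prodE : ∀ t → I t ≋ prodE (children t)
  I≋prodE (node [])      = ≋-refl
  I≋prodE (node (_ ∷ _)) = ≋-refl

  prodE-++ : ∀ xs ys → prodE (xs ++ ys) ≋ prodE xs *ₚ prodE ys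
  prodE-++ []       ys = ≋-sym (*ₚ-identityˡ _)
  prodE-++ (x ∷ xs) ys =
    ≋-trans (*ₚ-congʳ (e (I x)) (prodE-++ xs ys)) (≋-sym (*ₚ-assoc (e (I x)) (prodE xs) (prodE ys)))

  prodE-pick : ∀ cs (i : Fin (length cs)) →
    prodE cs ≋ e (I (lookup cs i)) *ₚ prodE (removeAt cs i)
  prodE-pick (x ∷ cs) zero    = ≋-refl
  prodE-pick (x ∷ cs) (suc i) =
    ≋-trans (*ₚ-congʳ (e (I x)) (prodE-pick cs i))
            (*ₚ-swap (e (I x)) (e (I (lookup cs i))) (prodE (removeAt cs i)))

  -- The factor contributed by the part of the tree above the current vertex.
  above : Maybe RTree → Pol
  above nothing  = 1ₚ
  above (just u) = e (I u)

  I-rootedHere : ∀ up cs → I (rerootWith up (node cs) here) ≋ prodE cs *ₚ above up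
  I-rootedHere nothing  cs = ≋-trans (I≋prodE (node (cs ++ []))) (prodE-++ cs [])
  I-rootedHere (just u) cs =
    ≋-trans (I≋prodE (node (cs ++ u ∷ [])))
      (≋-trans (prodE-++ cs (u ∷ [])) (*ₚ-congʳ (prodE cs) (*ₚ-identityʳ (e (I u)))))

  -- One rerooting step, from a vertex to its i-th child: this is e-adjoint
  -- with A the product at the child and B the product at the old root.
  reroot-step : ∀ up cs (i : Fin (length cs)) →
    f (prodE (children (lookup cs i)) *ₚ e (I (rerootWith up (node (removeAt cs i)) here)))
      ≈ f (prodE cs *ₚ above up)
  reroot-step up cs i = begin
    f (A *ₚ e (I (rerootWith up (node rest) here)))  ≈⟨ e-adjoint A (I (rerootWith up (node rest) here)) ⟩
    f (e A *ₚ I (rerootWith up (node rest) here))    ≈⟨ f-cong (*ₚ-congˡ (I (rerootWith up (node rest) here)) (e-cong (≋-sym (I≋prodE picked)))) ⟩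
    f (e (I picked) *ₚ I (rerootWith up (node rest) here))
      ≈⟨ f-cong (*ₚ-congʳ (e (I picked)) (I-rootedHere up rest)) ⟩
    f (e (I picked) *ₚ (prodE rest *ₚ above up))      ≈⟨ f-cong (*ₚ-assoc (e (I picked)) (prodE rest) (above up)) ⟨
    f ((e (I picked) *ₚ prodE rest) *ₚ above up)      ≈⟨ f-cong (*ₚ-congˡ (above up) (prodE-pick cs i)) ⟨
    f (prodE cs *ₚ above up)                         ∎
    where
    open SetoidReasoning setoid
    picked : RTree
    picked = lookup cs i
    rest : List RTree
    rest = removeAt cs i
    A : Pol
    A = prodE (children picked)

  rerootWith-invariant : ∀ up t (v : Pos t) →
    f (I (rerootWith up t v)) ≈ f (prodE (children t) *ₚ above up)
  rerootWith-invariant up (node cs) here        = f-cong (I-rootedHere up cs)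
  rerootWith-invariant up (node cs) (child i v) =
    trans (rerootWith-invariant _ (lookup cs i) v) (reroot-step up cs i)

  reroot-invariant : (T : RTree) (v : Pos T) → f (I T) ≈ f (I (reroot T v))
  reroot-invariant T v = begin
    f (I T)                           ≈⟨ f-cong (I≋prodE T) ⟩
    f (prodE (children T))            ≈⟨ f-cong (*ₚ-identityʳ (prodE (children T))) ⟨
    f (prodE (children T) *ₚ 1ₚ)      ≈⟨ rerootWith-invariant nothing T v ⟨
    f (I (reroot T v))                ∎
    where open SetoidReasoning setoid

proposition1 : {c ℓ : Level} (R : CommutativeSemiring c ℓ)
    (z : ℕ → CommutativeSemiring.Carrier R) →
    let open CommutativeSemiring R
        open Poly R z
    in ((A B : Pol) → f (A *ₚ e B) ≈ f (e A *ₚ B))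
       × ((T : RTree) (v : Pos T) → f (I T) ≈ f (I (reroot T v)))
proposition1 R z = Proof.e-adjoint R z , Proof.reroot-invariant R z
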